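{- For every $k \in \mathbb{N}$, let $H_k$ be the graph obtained from $k$ disjoint paths $P^1,\dots,P^k$, each on three vertices, by choosing an end-vertex $v_i$ of each $P^i$ and adding all edges between $v_1,\dots,v_k$, and let $G_k$ be obtained from $H_k$ by attaching a new pendant vertex to every pendant (degree-one) vertex of $H_k$. Then $G_k$ is $(P_9,C_9)$-free, and for every $k \ge 2$, $\gamma(G_k) = k+1$ and $\gamma_c(G_k) = 3k$. In particular $\lim_{k\to\infty} \gamma_c(G_k)/\gamma(G_k) = 3$.
   Context: $\gamma(G)$ is the minimum size of a dominating set of $G$ (a set $X$ such that every vertex outside $X$ has a neighbor in $X$); $\gamma_c(G)$ is the minimum size of a dominating set inducing a connected subgraph. $P_k$, $C_k$ denote the path and cycle on $k$ vertices; $(P_9,C_9)$-free means no induced $P_9$ and no induced $C_9$. -}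

module Defs where

open import Data.Nat using (ℕ; zero; suc; _+_; _*_; _≤_)
open import Data.Bool using (Bool; true; false; T; _∧_; _∨_; if_then_else_)
open import Data.Fin using (Fin; toℕ; splitAt; remQuot) renaming (_≟_ to _≟F_)
open import Data.Fin.Subset using (Subset; _∈_; ∣_∣)
open import Data.List using (List; filter; length; lookup; allFin)
open import Data.Sum using (_⊎_; inj₁; inj₂)
open import Data.Product using (Σ; ∃; _×_; _,_)
open import Relation.Binary.PropositionalEquality using (_≡_)
open import Relation.Nullary using (Dec; yes; no; ¬_)
open import Relation.Nullary.Decidable using (⌊_⌋)
open import Function.Definitions using (Injective)
import Data.Nat as N

-- A finite simple graph on vertex set Fin n, given by a Boolean adjacency
-- function (all graphs below are symmetric and loopless by construction).
record Graph : Set where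
  field
    n   : ℕ
    adj : Fin n → Fin n → Bool
open Graph public

Adj : (G : Graph) → Fin (n G) → Fin (n G) → Set
Adj G u v = T (adj G u v)

deg : (G : Graph) → Fin (n G) → ℕ
deg G u = length (filter (λ v → T? (adj G u v)) (allFin (n G)))
  where
  T? : (b : Bool) → Dec (T b)
  T? true  = yes _
  T? false = no (λ ())

pendants : (G : Graph) → List (Fin (n G))
pendants G = filter (λ u → deg G u N.≟ 1) (allFin (n G))

attachPendants : Graph → Graph
attachPendants G = record { n = n G + length (pendants G) ; adj = a }
  where
  a : Fin (n G + length (pendants G)) → Fin (n G + length (pendants G)) → Bool
  a x y with splitAt (n G) x | splitAt (n G) y
  ... | inj₁ u | inj₁ v = adj G u v
  ... | inj₁ u | inj₂ j = ⌊ u ≟F lookup (pendants G) j ⌋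
  ... | inj₂ j | inj₁ v = ⌊ v ≟F lookup (pendants G) j ⌋
  ... | inj₂ _ | inj₂ _ = false

-- position p on the path P^i = v_i — a_i — b_i : 0 = v_i (chosen end), 1, 2
pathEdge : Fin 3 → Fin 3 → Bool
pathEdge p q = ⌊ suc (toℕ p) N.≟ toℕ q ⌋ ∨ ⌊ suc (toℕ q) N.≟ toℕ p ⌋

-- H_k : vertex (i , p) of Fin k × Fin 3 encoded in Fin (k * 3)
H : ℕ → Graph
H k = record { n = k * 3 ; adj = a }
  where
  a : Fin (k * 3) → Fin (k * 3) → Bool
  a x y with remQuot {k} 3 x | remQuot {k} 3 y
  ... | (i , p) | (j , q) with i ≟F j
  ... | yes _ = pathEdge p q
  ... | no  _ = ⌊ toℕ p N.≟ 0 ⌋ ∧ ⌊ toℕ q N.≟ 0 ⌋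

G : ℕ → Graph
G k = attachPendants (H k)

PathRel : (m : ℕ) → Fin m → Fin m → Set
PathRel m i j = (suc (toℕ i) ≡ toℕ j) ⊎ (suc (toℕ j) ≡ toℕ i)

CycleRel : (m : ℕ) → Fin m → Fin m → Set
CycleRel m i j = PathRel m i j
               ⊎ ((toℕ i ≡ 0 × suc (toℕ j) ≡ m) ⊎ (toℕ j ≡ 0 × suc (toℕ i) ≡ m))

HasInduced : (Gr : Graph) (m : ℕ) → (Fin m → Fin m → Set) → Set
HasInduced Gr m R = Σ (Fin m → Fin (n Gr)) λ f →
  Injective _≡_ _≡_ f × (∀ i j → (Adj Gr (f i) (f j) → R i j) × (R i j → Adj Gr (f i) (f j)))

P-free : ℕ → Graph → Set
P-free m Gr = ¬ HasInduced Gr m (PathRel m)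

C-free : ℕ → Graph → Set
C-free m Gr = ¬ HasInduced Gr m (CycleRel m)

Dominating : (Gr : Graph) → Subset (n Gr) → Set
Dominating Gr X = ∀ v → v ∈ X ⊎ ∃ λ u → u ∈ X × Adj Gr u v

data ReachIn (Gr : Graph) (X : Subset (n Gr)) : Fin (n Gr) → Fin (n Gr) → Set where
  here : ∀ {u} → u ∈ X → ReachIn Gr X u u
  step : ∀ {u w v} → u ∈ X → Adj Gr u w → ReachIn Gr X w v → ReachIn Gr X u v

InducesConnected : (Gr : Graph) → Subset (n Gr) → Set
InducesConnected Gr X = ∀ u v → u ∈ X → v ∈ X → ReachIn Gr X u v

ConnDominating : (Gr : Graph) → Subset (n Gr) → Set
ConnDominating Gr X = Dominating Gr X × InducesConnected Gr X

IsDomNumber : Graph → ℕ → Set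
IsDomNumber Gr m = (∃ λ X → Dominating Gr X × ∣ X ∣ ≡ m)
                 × (∀ X → Dominating Gr X → m ≤ ∣ X ∣)

IsConnDomNumber : Graph → ℕ → Set
IsConnDomNumber Gr m = (∃ λ X → ConnDominating Gr X × ∣ X ∣ ≡ m)
                     × (∀ X → ConnDominating Gr X → m ≤ ∣ X ∣)

-- Off its hubs v i the graph H k is the matching {a i b i}, so every walk x y z in H k with x ≠ z
-- meets a hub, and the hubs form a clique. In an induced P₉ or C₉ of G k the vertices 1, …, 7 have
-- two neighbours, so they are not new pendants and lie in H k; the segments 1 2 3 and 5 6 7 then
-- each contain a hub, and these two hubs are adjacent although they are at distance at least 2.
--
-- For k ≥ 2 the pendants of H k are exactly the b i, so G k hangs a leaf c i on every b i. A
-- dominating set meets each {b i, c i} and also N[v i₀], which avoids all of them; conversely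
-- {v i₀, b 1, …, b k} dominates. A connected dominating set contains a vertex near c i and one near
-- some c j with j ≠ i, and a walk between them must leave the arm {a i, b i, c i} through a i v i and
-- {b i, c i} through b i a i; so it contains all 3k vertices of H k, which form a connected
-- dominating set themselves. Hence γ_c / γ = 3k / (k + 1) → 3.

module Submission where

open import Defs
open import Data.Bool using (Bool; false; T; _∧_)
open import Data.Empty using (⊥; ⊥-elim)
open import Data.Fin as Fin
  using (Fin; zero; suc; #_; toℕ; splitAt; join; combine; remQuot; _↑ˡ_; _↑ʳ_) renaming (_≟_ to _≟ᶠ_)
open import Data.Fin.Properties
  using ( suc-injective; 0≢1+n; splitAt-↑ˡ; splitAt-↑ʳ; join-splitAt; ↑ˡ-injective; ↑ʳ-injective
        ; combine-remQuot; remQuot-combine; combine-injective)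
import Data.Fin.Subset as Subset
open import Data.Fin.Subset using (Subset; _∈_; _∪_; ⁅_⁆; inside; outside) renaming (⊥ to ∅; _-_ to _∖_)
open import Data.Fin.Subset.Properties
  using (x∈p∪q⁺; x∈p∪q⁻; x∈⁅x⁆; x∈⁅y⁆⇒x≡y; ∉⊥; ∣⊥∣≡0; ∣⁅x⁆∣≡1; x∈p∧x≢y⇒x∈p-y; x∈p⇒∣p-x∣<∣p∣)
open import Data.Integer as ℤ using (+_; -[1+_]; +<+)
import Data.Integer.Properties as ℤₚ
open import Data.Integer.Tactic.RingSolver using (solve-∀)
open import Data.List using ([]; _∷_; filter; length; lookup; allFin)
open import Data.List.Membership.Propositional using () renaming (_∈_ to _∈ₗ_)
open import Data.List.Membership.Propositional.Properties using (∈-lookup; ∈-filter⁺; ∈-filter⁻; ∈-allFin)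
open import Data.List.Relation.Unary.All using (_∷_)
open import Data.List.Relation.Unary.AllPairs using (_∷_)
open import Data.List.Relation.Unary.Any as Any using (here; there)
open import Data.List.Relation.Unary.Any.Properties using (lookup-index)
open import Data.List.Relation.Unary.Unique.Propositional using (Unique)
open import Data.List.Relation.Unary.Unique.Propositional.Properties using (filter⁺; allFin⁺)
open import Data.Nat as ℕ using (ℕ; zero; suc; _+_; _*_; _≤_; z≤n; s≤s; NonZero)
open import Data.Nat.Coprimality using (Coprime)
open import Data.Nat.Properties
  using ( ≤-trans; ≤-reflexive; ≤-antisym; ≤ᵇ⇒≤; 1+n≰n; m≤n⇒m≤1+n; m≤m+n; m+n≤o⇒n≤o; m≤n*m
        ; +-suc; +-comm; *-comm; *-identityʳ; +-mono-≤)
open import Data.Product using (Σ; ∃; _×_; _,_; proj₁; proj₂)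
open import Data.Rational using (ℚ; mkℚ; _/_; -_; _-_; ∣_∣; _<_; 0ℚ; toℚᵘ; *<*)
open import Data.Rational.Properties using (toℚᵘ-homo-+; toℚᵘ-homo‿-; toℚᵘ-fromℚᵘ; toℚᵘ-cancel-<)
import Data.Rational.Unnormalised as ℚᵘ
import Data.Rational.Unnormalised.Properties as ℚᵘₚ
open import Data.Sum as Sum using (_⊎_; inj₁; inj₂; [_,_]′)
open import Data.Unit using (tt)
open import Data.Vec using ([]; _∷_)
open import Function using (_∘_)
open import Function.Definitions using (Injective)
open import Level using (0ℓ)
open import Relation.Binary.PropositionalEquality using (_≡_; _≢_; refl; sym; trans; cong; cong₂; subst; subst₂)
open import Relation.Nullary using (¬_; yes; no)
open import Relation.Nullary.Decidable using (⌊_⌋; toWitness; fromWitness)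
open import Relation.Unary using (Pred; Decidable)

∣p∪q∣≤∣p∣+∣q∣ : ∀ {n} (p q : Subset n) → Subset.∣ p ∪ q ∣ ≤ Subset.∣ p ∣ + Subset.∣ q ∣
∣p∪q∣≤∣p∣+∣q∣ []            []            = z≤n
∣p∪q∣≤∣p∣+∣q∣ (inside  ∷ p) (inside  ∷ q) =
  s≤s (≤-trans (m≤n⇒m≤1+n (∣p∪q∣≤∣p∣+∣q∣ p q)) (≤-reflexive (sym (+-suc Subset.∣ p ∣ Subset.∣ q ∣))))
∣p∪q∣≤∣p∣+∣q∣ (inside  ∷ p) (outside ∷ q) = s≤s (∣p∪q∣≤∣p∣+∣q∣ p q)
∣p∪q∣≤∣p∣+∣q∣ (outside ∷ p) (inside  ∷ q) =
  ≤-trans (s≤s (∣p∪q∣≤∣p∣+∣q∣ p q)) (≤-reflexive (sym (+-suc Subset.∣ p ∣ Subset.∣ q ∣)))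
∣p∪q∣≤∣p∣+∣q∣ (outside ∷ p) (outside ∷ q) = ∣p∪q∣≤∣p∣+∣q∣ p q

image : ∀ {m n} → (Fin m → Fin n) → Subset n
image {zero}  f = ∅
image {suc m} f = ⁅ f zero ⁆ ∪ image (f ∘ suc)

∈-image : ∀ {m n} (f : Fin m → Fin n) t → f t ∈ image f
∈-image f zero    = x∈p∪q⁺ (inj₁ (x∈⁅x⁆ (f zero)))
∈-image f (suc t) = x∈p∪q⁺ (inj₂ (∈-image (f ∘ suc) t))

∈-image⁻ : ∀ {m n} (f : Fin m → Fin n) {x} → x ∈ image f → ∃ λ t → f t ≡ x
∈-image⁻ {zero}  f x∈ = ⊥-elim (∉⊥ x∈)
∈-image⁻ {suc m} f x∈ with x∈p∪q⁻ ⁅ f zero ⁆ (image (f ∘ suc)) x∈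
... | inj₁ x∈⁅f0⁆ = zero , sym (x∈⁅y⁆⇒x≡y (f zero) x∈⁅f0⁆)
... | inj₂ x∈rest with ∈-image⁻ (f ∘ suc) x∈rest
...   | t , ft≡x = suc t , ft≡x

∣image∣≤ : ∀ {m n} (f : Fin m → Fin n) → Subset.∣ image f ∣ ≤ m
∣image∣≤ {zero}  {n} f = ≤-reflexive (∣⊥∣≡0 n)
∣image∣≤ {suc m}     f = ≤-trans (∣p∪q∣≤∣p∣+∣q∣ ⁅ f zero ⁆ (image (f ∘ suc)))
                                 (+-mono-≤ (≤-reflexive (∣⁅x⁆∣≡1 (f zero))) (∣image∣≤ (f ∘ suc)))

injective⇒≤∣p∣ : ∀ {m n} (p : Subset n) (f : Fin m → Fin n) →
                 Injective _≡_ _≡_ f → (∀ t → f t ∈ p) → m ≤ Subset.∣ p ∣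
injective⇒≤∣p∣ {zero}  p f f-inj f∈p = z≤n
injective⇒≤∣p∣ {suc m} p f f-inj f∈p = ≤-trans (s≤s rest≤) (x∈p⇒∣p-x∣<∣p∣ (f∈p zero))
  where
  rest≤ : m ≤ Subset.∣ p ∖ f zero ∣
  rest≤ = injective⇒≤∣p∣ (p ∖ f zero) (f ∘ suc) (suc-injective ∘ f-inj)
            (λ t → x∈p∧x≢y⇒x∈p-y (f∈p (suc t)) (0≢1+n ∘ f-inj ∘ sym))

∣image∣≡ : ∀ {m n} (f : Fin m → Fin n) → Injective _≡_ _≡_ f → Subset.∣ image f ∣ ≡ m
∣image∣≡ f f-inj = ≤-antisym (∣image∣≤ f) (injective⇒≤∣p∣ (image f) f f-inj (∈-image f))

module _ {A : Set} where

  1≤length : ∀ {x : A} {ys} → x ∈ₗ ys → 1 ≤ length ys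
  1≤length {ys = _ ∷ _} _ = s≤s z≤n

  2≤length : ∀ {x y : A} {ys} → x ∈ₗ ys → y ∈ₗ ys → x ≢ y → 2 ≤ length ys
  2≤length (here refl) (here refl) x≢y = ⊥-elim (x≢y refl)
  2≤length (here refl) (there y∈) _   = s≤s (1≤length y∈)
  2≤length (there x∈)  (here refl) _  = s≤s (1≤length x∈)
  2≤length (there x∈)  (there y∈) x≢y = m≤n⇒m≤1+n (2≤length x∈ y∈ x≢y)

  length≤1 : ∀ {x : A} {ys} → Unique ys → (∀ {y} → y ∈ₗ ys → y ≡ x) → length ys ≤ 1
  length≤1 {ys = []}        _                ≡x = z≤n
  length≤1 {ys = _ ∷ []}    _                ≡x = s≤s z≤n
  length≤1 {ys = _ ∷ _ ∷ _} ((y≢z ∷ _) ∷ _) ≡x =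
    ⊥-elim (y≢z (trans (≡x (here refl)) (sym (≡x (there (here refl))))))

  module _ {P : Pred A 0ℓ} (P? : Decidable P) where

    2≤length-filter : ∀ {xs x y} → x ∈ₗ xs → y ∈ₗ xs → x ≢ y → P x → P y → 2 ≤ length (filter P? xs)
    2≤length-filter x∈ y∈ x≢y Px Py = 2≤length (∈-filter⁺ P? x∈ Px) (∈-filter⁺ P? y∈ Py) x≢y

    length-filter≡1 : ∀ {xs x} → Unique xs → x ∈ₗ xs → P x → (∀ y → P y → y ≡ x) → length (filter P? xs) ≡ 1
    length-filter≡1 {xs} uniq x∈ Px only-x =
      ≤-antisym (length≤1 (filter⁺ P? uniq) (λ y∈ → only-x _ (proj₂ (∈-filter⁻ P? {xs = xs} y∈))))
                (1≤length (∈-filter⁺ P? x∈ Px))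

module _ (Gr : Graph) where

  deg≡1 : ∀ {u w} → Adj Gr u w → (∀ y → Adj Gr u y → y ≡ w) → deg Gr u ≡ 1
  deg≡1 {w = w} u~w only-w = length-filter≡1 _ (allFin⁺ (n Gr)) (∈-allFin w) u~w only-w

  2≤deg : ∀ {u x y} → x ≢ y → Adj Gr u x → Adj Gr u y → 2 ≤ deg Gr u
  2≤deg x≢y u~x u~y = 2≤length-filter _ (∈-allFin _) (∈-allFin _) x≢y u~x u~y

  ∈pendants⁺ : ∀ {u} → deg Gr u ≡ 1 → u ∈ₗ pendants Gr
  ∈pendants⁺ deg≡ = ∈-filter⁺ _ (∈-allFin _) deg≡

  ∈pendants⁻ : ∀ {u} → u ∈ₗ pendants Gr → deg Gr u ≡ 1
  ∈pendants⁻ u∈ = proj₂ (∈-filter⁻ _ {xs = allFin (n Gr)} u∈)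

  IsDomNumber-unique : ∀ {m m′} → IsDomNumber Gr m → IsDomNumber Gr m′ → m ≡ m′
  IsDomNumber-unique ((X , dom , refl) , min) ((X′ , dom′ , refl) , min′) = ≤-antisym (min X′ dom′) (min′ X dom)

  IsConnDomNumber-unique : ∀ {m m′} → IsConnDomNumber Gr m → IsConnDomNumber Gr m′ → m ≡ m′
  IsConnDomNumber-unique ((X , cd , refl) , min) ((X′ , cd′ , refl) , min′) = ≤-antisym (min X′ cd′) (min′ X cd)

  dominator : ∀ {X} → Dominating Gr X → ∀ y → ∃ λ x → x ∈ X × (x ≡ y ⊎ Adj Gr x y)
  dominator dom y with dom y
  ... | inj₁ y∈X            = y , y∈X , inj₁ refl
  ... | inj₂ (x , x∈X , x~y) = x , x∈X , inj₂ x~y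

  module _ {X : Subset (n Gr)} where

    ReachIn-source : ∀ {u w} → ReachIn Gr X u w → u ∈ X
    ReachIn-source (here u∈X)     = u∈X
    ReachIn-source (step u∈X _ _) = u∈X

    ReachIn-trans : ∀ {u w y} → ReachIn Gr X u w → ReachIn Gr X w y → ReachIn Gr X u y
    ReachIn-trans (here _)           r = r
    ReachIn-trans (step u∈X u~ rest) r = step u∈X u~ (ReachIn-trans rest r)

    ReachIn-edge : ∀ {u w} → u ∈ X → w ∈ X → Adj Gr u w → ReachIn Gr X u w
    ReachIn-edge u∈X w∈X u~w = step u∈X u~w (here w∈X)

    exit∈ : (R : Fin (n Gr) → Set) {e f : Fin (n Gr)} →
            (∀ {s w} → R s → Adj Gr s w → R w ⊎ (s ≡ e × w ≡ f)) →
            ∀ {s t} → ReachIn Gr X s t → R s → ¬ R t → e ∈ X × f ∈ X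
    exit∈ R closed (here _)            Rs ¬Rt = ⊥-elim (¬Rt Rs)
    exit∈ R closed (step s∈X s~w rest) Rs ¬Rt with closed Rs s~w
    ... | inj₁ Rw          = exit∈ R closed rest Rw ¬Rt
    ... | inj₂ (refl , refl) = s∈X , ReachIn-source rest

module AttachPendants (Gr : Graph) where

  private
    m = n Gr
    ℓ = length (pendants Gr)

  Gr⁺ : Graph
  Gr⁺ = attachPendants Gr

  old : Fin m → Fin (n Gr⁺)
  old u = u ↑ˡ ℓ

  new : Fin ℓ → Fin (n Gr⁺)
  new j = m ↑ʳ j

  attachedTo : Fin ℓ → Fin m
  attachedTo = lookup (pendants Gr)

  data OldOrNew : Fin (n Gr⁺) → Set where
    isOld : ∀ u → OldOrNew (old u)
    isNew : ∀ j → OldOrNew (new j)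

  oldOrNew : ∀ x → OldOrNew x
  oldOrNew x with splitAt m x in eq
  ... | inj₁ u = subst OldOrNew (trans (cong (join m ℓ) (sym eq)) (join-splitAt m ℓ x)) (isOld u)
  ... | inj₂ j = subst OldOrNew (trans (cong (join m ℓ) (sym eq)) (join-splitAt m ℓ x)) (isNew j)

  old-injective : ∀ {u w} → old u ≡ old w → u ≡ w
  old-injective = ↑ˡ-injective ℓ _ _

  new-injective : ∀ {i j} → new i ≡ new j → i ≡ j
  new-injective = ↑ʳ-injective m _ _

  old≢new : ∀ {u j} → old u ≢ new j
  old≢new {u} {j} eq with trans (sym (splitAt-↑ˡ m u ℓ)) (trans (cong (splitAt m) eq) (splitAt-↑ʳ m ℓ j))
  ... | ()

  adj-old-old : ∀ u w → adj Gr⁺ (old u) (old w) ≡ adj Gr u w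
  adj-old-old u w rewrite splitAt-↑ˡ m u ℓ | splitAt-↑ˡ m w ℓ = refl

  adj-old-new : ∀ u j → adj Gr⁺ (old u) (new j) ≡ ⌊ u ≟ᶠ attachedTo j ⌋
  adj-old-new u j rewrite splitAt-↑ˡ m u ℓ | splitAt-↑ʳ m ℓ j = refl

  adj-new-old : ∀ j w → adj Gr⁺ (new j) (old w) ≡ ⌊ w ≟ᶠ attachedTo j ⌋
  adj-new-old j w rewrite splitAt-↑ʳ m ℓ j | splitAt-↑ˡ m w ℓ = refl

  adj-new-new : ∀ i j → adj Gr⁺ (new i) (new j) ≡ false
  adj-new-new i j rewrite splitAt-↑ʳ m ℓ i | splitAt-↑ʳ m ℓ j = refl

  Adj-old⁺ : ∀ {u w} → Adj Gr u w → Adj Gr⁺ (old u) (old w)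
  Adj-old⁺ {u} {w} = subst T (sym (adj-old-old u w))

  Adj-old⁻ : ∀ {u w} → Adj Gr⁺ (old u) (old w) → Adj Gr u w
  Adj-old⁻ {u} {w} = subst T (adj-old-old u w)

  Adj-attached : ∀ {u j} → attachedTo j ≡ u → Adj Gr⁺ (old u) (new j)
  Adj-attached {u} {j} u≡ = subst T (sym (adj-old-new u j)) (fromWitness (sym u≡))

  Adj-new⁻ : ∀ {j y} → Adj Gr⁺ (new j) y → y ≡ old (attachedTo j)
  Adj-new⁻ {j} {y} j~y with oldOrNew y
  ... | isOld w = cong old (toWitness (subst T (adj-new-old j w) j~y))
  ... | isNew i = ⊥-elim (subst T (adj-new-new j i) j~y)

  Adj-into-new⁻ : ∀ {j y} → Adj Gr⁺ y (new j) → y ≡ old (attachedTo j)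
  Adj-into-new⁻ {j} {y} y~j with oldOrNew y
  ... | isOld w = cong old (toWitness (subst T (adj-old-new w j) y~j))
  ... | isNew i = ⊥-elim (subst T (adj-new-new i j) y~j)

  two-neighbours⇒old : ∀ {x y z} → y ≢ z → Adj Gr⁺ x y → Adj Gr⁺ x z → ∃ λ u → x ≡ old u
  two-neighbours⇒old {x} y≢z x~y x~z with oldOrNew x
  ... | isOld u = u , refl
  ... | isNew j = ⊥-elim (y≢z (trans (Adj-new⁻ x~y) (sym (Adj-new⁻ x~z))))

pattern 0F = zero
pattern 1F = suc 0F
pattern 2F = suc 1F

module PathsWithClique (k : ℕ) where

  vtx : Fin k → Fin 3 → Fin (k * 3)
  vtx = combine

  v a b : Fin k → Fin (k * 3)
  v i = vtx i 0F
  a i = vtx i 1F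
  b i = vtx i 2F

  data OnPath : Fin (k * 3) → Set where
    at : ∀ i p → OnPath (vtx i p)

  onPath : ∀ x → OnPath x
  onPath x = subst OnPath (combine-remQuot {k} 3 x) (at (proj₁ (remQuot {k} 3 x)) (proj₂ (remQuot {k} 3 x)))

  vtx-injective : ∀ {i j p q} → vtx i p ≡ vtx j q → i ≡ j × p ≡ q
  vtx-injective = combine-injective _ _ _ _

  adjacency : Fin k × Fin 3 → Fin k × Fin 3 → Bool
  adjacency (i , p) (j , q) with i ≟ᶠ j
  ... | yes _ = pathEdge p q
  ... | no  _ = ⌊ toℕ p ℕ.≟ 0 ⌋ ∧ ⌊ toℕ q ℕ.≟ 0 ⌋

  adj-H : ∀ x y → adj (H k) x y ≡ adjacency (remQuot 3 x) (remQuot 3 y)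
  adj-H x y with Fin.quotRem {k} 3 x | Fin.quotRem {k} 3 y
  ... | _ , i | _ , j with i ≟ᶠ j
  ...   | yes _ = refl
  ...   | no  _ = refl

  adj-vtx : ∀ i p j q → adj (H k) (vtx i p) (vtx j q) ≡ adjacency (i , p) (j , q)
  adj-vtx i p j q = trans (adj-H (vtx i p) (vtx j q)) (cong₂ adjacency (remQuot-combine i p) (remQuot-combine j q))

  adj-same : ∀ i p q → adj (H k) (vtx i p) (vtx i q) ≡ pathEdge p q
  adj-same i p q with i ≟ᶠ i | adj-vtx i p i q
  ... | yes _   | eq = eq
  ... | no i≢i | _  = ⊥-elim (i≢i refl)

  adj-diff : ∀ {i j} p q → i ≢ j → adj (H k) (vtx i p) (vtx j q) ≡ ⌊ toℕ p ℕ.≟ 0 ⌋ ∧ ⌊ toℕ q ℕ.≟ 0 ⌋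
  adj-diff {i} {j} p q i≢j with i ≟ᶠ j | adj-vtx i p j q
  ... | yes i≡j | _  = ⊥-elim (i≢j i≡j)
  ... | no _    | eq = eq

  pathEdge-from-b : ∀ q → T (pathEdge 2F q) → q ≡ 1F
  pathEdge-from-b 1F _ = refl
  pathEdge-from-b 0F ()
  pathEdge-from-b 2F ()

  pathEdge-from-a : ∀ q → T (pathEdge 1F q) → q ≡ 0F ⊎ q ≡ 2F
  pathEdge-from-a 0F _ = inj₁ refl
  pathEdge-from-a 2F _ = inj₂ refl
  pathEdge-from-a 1F ()

  pathEdge-into-v : ∀ q → T (pathEdge q 0F) → q ≡ 1F
  pathEdge-into-v 1F _ = refl
  pathEdge-into-v 0F ()
  pathEdge-into-v 2F ()

  Adj-path : ∀ {i p q} → T (pathEdge p q) → Adj (H k) (vtx i p) (vtx i q)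
  Adj-path {i} {p} {q} = subst T (sym (adj-same i p q))

  v~a : ∀ {i} → Adj (H k) (v i) (a i)
  v~a = Adj-path tt

  a~v : ∀ {i} → Adj (H k) (a i) (v i)
  a~v = Adj-path tt

  a~b : ∀ {i} → Adj (H k) (a i) (b i)
  a~b = Adj-path tt

  b~a : ∀ {i} → Adj (H k) (b i) (a i)
  b~a = Adj-path tt

  Adj-v-v : ∀ {i j} → i ≢ j → Adj (H k) (v i) (v j)
  Adj-v-v i≢j = subst T (sym (adj-diff 0F 0F i≢j)) tt

  Adj-vtx⁻ : ∀ {i j p q} → Adj (H k) (vtx i p) (vtx j q) →
             (i ≡ j × T (pathEdge p q)) ⊎ (i ≢ j × p ≡ 0F × q ≡ 0F)
  Adj-vtx⁻ {i} {j} {p} {q} i~j with i ≟ᶠ j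
  ... | yes refl = inj₁ (refl , subst T (adj-same i p q) i~j)
  ... | no i≢j with p | q | subst T (adj-diff p q i≢j) i~j
  ...   | 0F | 0F | _ = inj₂ (i≢j , refl , refl)

  Adj-b⁻ : ∀ {i y} → Adj (H k) (b i) y → y ≡ a i
  Adj-b⁻ {i} {y} b~y with onPath y
  ... | at j q with Adj-vtx⁻ b~y
  ...   | inj₁ (refl , e)    = cong (vtx i) (pathEdge-from-b q e)
  ...   | inj₂ (_ , () , _)

  Adj-a⁻ : ∀ {i y} → Adj (H k) (a i) y → y ≡ v i ⊎ y ≡ b i
  Adj-a⁻ {i} {y} a~y with onPath y
  ... | at j q with Adj-vtx⁻ a~y
  ...   | inj₁ (refl , e)    = Sum.map (cong (vtx i)) (cong (vtx i)) (pathEdge-from-a q e)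
  ...   | inj₂ (_ , () , _)

  Adj-into-v⁻ : ∀ {i y} → Adj (H k) y (v i) → y ≡ a i ⊎ ∃ λ j → y ≡ v j
  Adj-into-v⁻ {i} {y} y~v with onPath y
  ... | at j q with Adj-vtx⁻ y~v
  ...   | inj₁ (refl , e)     = inj₁ (cong (vtx i) (pathEdge-into-v q e))
  ...   | inj₂ (_ , refl , _) = inj₂ (j , refl)

  IsHub : Fin (k * 3) → Set
  IsHub x = ∃ λ i → x ≡ v i

  pathEdge-off-hub : ∀ p q r → T (pathEdge (suc p) (suc q)) → T (pathEdge (suc q) (suc r)) → p ≡ r
  pathEdge-off-hub 0F 0F _  ()
  pathEdge-off-hub 0F 1F 0F _ _  = refl
  pathEdge-off-hub 0F 1F 1F _ ()
  pathEdge-off-hub 1F 0F 0F _ ()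
  pathEdge-off-hub 1F 0F 1F _ _  = refl
  pathEdge-off-hub 1F 1F _  ()

  hub-on-walk : ∀ {x y z} → Adj (H k) x y → Adj (H k) y z → x ≢ z → IsHub x ⊎ IsHub y ⊎ IsHub z
  hub-on-walk {x} {y} {z} x~y y~z x≢z with onPath x | onPath y | onPath z
  ... | at i 0F       | _            | _       = inj₁ (i , refl)
  ... | at _ (suc _) | at j 0F      | _       = inj₂ (inj₁ (j , refl))
  ... | at _ (suc _) | at _ (suc _) | at l 0F = inj₂ (inj₂ (l , refl))
  ... | at i (suc p) | at j (suc q) | at l (suc r) with Adj-vtx⁻ x~y | Adj-vtx⁻ y~z
  ...   | inj₁ (refl , e) | inj₁ (refl , e′) = ⊥-elim (x≢z (cong (vtx i ∘ suc) (pathEdge-off-hub p q r e e′)))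
  ...   | inj₂ (_ , () , _) | _
  ...   | _ | inj₂ (_ , () , _)

-- For numerals the implicit argument is ⊤ and is filled in by evaluation.
≤-literal : ∀ {m n} {_ : T (m ℕ.≤ᵇ n)} → m ≤ n
≤-literal {m} {n} {m≤n} = ≤ᵇ⇒≤ m n m≤n

module Freeness (k : ℕ) where
  open AttachPendants (H k)
  open PathsWithClique k

  module _ (R : Fin 9 → Fin 9 → Set) (path⊆R : ∀ s t → PathRel 9 s t → R s t)
           (f : Fin 9 → Fin (n (G k))) (f-inj : Injective _≡_ _≡_ f)
           (f-adj : ∀ s t → (Adj (G k) (f s) (f t) → R s t) × (R s t → Adj (G k) (f s) (f t))) where

    edge : ∀ {s t} → PathRel 9 s t → Adj (G k) (f s) (f t)
    edge st = proj₂ (f-adj _ _) (path⊆R _ _ st)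

    OldAt : Fin 9 → Set
    OldAt s = ∃ λ u → f s ≡ old u

    HubAt : Fin 9 → Set
    HubAt s = ∃ λ i → f s ≡ old (v i)

    inner-old : ∀ s {t r} → t ≢ r → PathRel 9 s t → PathRel 9 s r → OldAt s
    inner-old s t≢r st sr = two-neighbours⇒old (t≢r ∘ f-inj) (edge st) (edge sr)

    hub-among : ∀ {s t r} → PathRel 9 s t → PathRel 9 t r → s ≢ r →
                OldAt s → OldAt t → OldAt r → HubAt s ⊎ HubAt t ⊎ HubAt r
    hub-among st tr s≢r (u , fs≡) (w , ft≡) (y , fr≡) =
      Sum.map (hub fs≡) (Sum.map (hub ft≡) (hub fr≡)) (hub-on-walk (edge-H st fs≡ ft≡) (edge-H tr ft≡ fr≡) u≢y)
      where
      edge-H : ∀ {s t u w} → PathRel 9 s t → f s ≡ old u → f t ≡ old w → Adj (H k) u w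
      edge-H st fs≡ ft≡ = Adj-old⁻ (subst₂ (Adj (G k)) fs≡ ft≡ (edge st))
      hub : ∀ {s u} → f s ≡ old u → IsHub u → HubAt s
      hub fs≡ (i , refl) = i , fs≡
      u≢y : u ≢ y
      u≢y u≡y = s≢r (f-inj (trans fs≡ (trans (cong old u≡y) (sym fr≡))))

    left-hub : ∃ λ s → 1 ≤ toℕ s × toℕ s ≤ 3 × HubAt s
    left-hub with hub-among (inj₁ refl) (inj₁ refl) (λ ())
                    (inner-old (# 1) {# 0} {# 2} (λ ()) (inj₂ refl) (inj₁ refl))
                    (inner-old (# 2) {# 1} {# 3} (λ ()) (inj₂ refl) (inj₁ refl))
                    (inner-old (# 3) {# 2} {# 4} (λ ()) (inj₂ refl) (inj₁ refl))
    ... | inj₁ h        = _ , ≤-literal , ≤-literal , h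
    ... | inj₂ (inj₁ h) = _ , ≤-literal , ≤-literal , h
    ... | inj₂ (inj₂ h) = _ , ≤-literal , ≤-literal , h

    right-hub : ∃ λ t → 5 ≤ toℕ t × HubAt t
    right-hub with hub-among (inj₁ refl) (inj₁ refl) (λ ())
                    (inner-old (# 5) {# 4} {# 6} (λ ()) (inj₂ refl) (inj₁ refl))
                    (inner-old (# 6) {# 5} {# 7} (λ ()) (inj₂ refl) (inj₁ refl))
                    (inner-old (# 7) {# 6} {# 8} (λ ()) (inj₂ refl) (inj₁ refl))
    ... | inj₁ h        = _ , ≤-literal , h
    ... | inj₂ (inj₁ h) = _ , ≤-literal , h
    ... | inj₂ (inj₂ h) = _ , ≤-literal , h

    hubs-adjacent : ∀ {s t} → s ≢ t → HubAt s → HubAt t → Adj (G k) (f s) (f t)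
    hubs-adjacent s≢t (i , fs≡) (j , ft≡) = subst₂ (Adj (G k)) (sym fs≡) (sym ft≡) (Adj-old⁺ (Adj-v-v i≢j))
      where
      i≢j : i ≢ j
      i≢j i≡j = s≢t (f-inj (trans fs≡ (trans (cong (old ∘ v) i≡j) (sym ft≡))))

    two-far-hubs : (∀ s t → 1 ≤ toℕ s → 2 + toℕ s ≤ toℕ t → ¬ R s t) → ⊥
    two-far-hubs far with left-hub | right-hub
    ... | s , 1≤s , s≤3 , hs | t , 5≤t , ht = far s t 1≤s s+2≤t (proj₁ (f-adj s t) (hubs-adjacent s≢t hs ht))
      where
      s+2≤t : 2 + toℕ s ≤ toℕ t
      s+2≤t = ≤-trans (+-mono-≤ (≤-reflexive refl) s≤3) 5≤t
      s≢t : s ≢ t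
      s≢t refl = 1+n≰n (m+n≤o⇒n≤o 1 s+2≤t)

  no-induced : (R : Fin 9 → Fin 9 → Set) → (∀ s t → PathRel 9 s t → R s t) →
               (∀ s t → 1 ≤ toℕ s → 2 + toℕ s ≤ toℕ t → ¬ R s t) → ¬ HasInduced (G k) 9 R
  no-induced R path⊆R far (f , f-inj , f-adj) = two-far-hubs R path⊆R f f-inj f-adj far

PathRel-far : ∀ s t → 1 ≤ toℕ s → 2 + toℕ s ≤ toℕ t → ¬ PathRel 9 s t
PathRel-far s t _ s+2≤t (inj₁ s+1≡t) = 1+n≰n (subst (2 + toℕ s ≤_) (sym s+1≡t) s+2≤t)
PathRel-far s t _ s+2≤t (inj₂ t+1≡s) = 1+n≰n (m+n≤o⇒n≤o 2 (subst (λ x → 2 + x ≤ toℕ t) (sym t+1≡s) s+2≤t))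

CycleRel-far : ∀ s t → 1 ≤ toℕ s → 2 + toℕ s ≤ toℕ t → ¬ CycleRel 9 s t
CycleRel-far s t 1≤s s+2≤t (inj₁ st)             = PathRel-far s t 1≤s s+2≤t st
CycleRel-far s t 1≤s s+2≤t (inj₂ (inj₁ (s≡0 , _))) with subst (1 ≤_) s≡0 1≤s
... | ()
CycleRel-far s t 1≤s s+2≤t (inj₂ (inj₂ (t≡0 , _))) with subst (2 + toℕ s ≤_) t≡0 s+2≤t
... | ()

G-P₉-free : ∀ k → P-free 9 (G k)
G-P₉-free k = Freeness.no-induced k (PathRel 9) (λ _ _ st → st) PathRel-far

G-C₉-free : ∀ k → C-free 9 (G k)
G-C₉-free k = Freeness.no-induced k (CycleRel 9) (λ _ _ → inj₁) CycleRel-far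

module Domination (k : ℕ) (i₀ i₁ : Fin k) (i₀≢i₁ : i₀ ≢ i₁) where
  open AttachPendants (H k)
  open PathsWithClique k

  other : Fin k → Fin k
  other i with i ≟ᶠ i₀
  ... | yes _ = i₁
  ... | no  _ = i₀

  other-≢ : ∀ i → other i ≢ i
  other-≢ i with i ≟ᶠ i₀
  ... | yes refl = i₀≢i₁ ∘ sym
  ... | no  i≢i₀ = i≢i₀ ∘ sym

  v≢b : ∀ {i j} → v i ≢ b j
  v≢b eq with proj₂ (vtx-injective eq)
  ... | ()

  a≢b : ∀ {i j} → a i ≢ b j
  a≢b eq with proj₂ (vtx-injective eq)
  ... | ()

  a≢v : ∀ {i j} → a i ≢ v j
  a≢v eq with proj₂ (vtx-injective eq)
  ... | ()

  deg-b : ∀ i → deg (H k) (b i) ≡ 1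
  deg-b i = deg≡1 (H k) b~a (λ _ → Adj-b⁻)

  2≤deg-a : ∀ i → 2 ≤ deg (H k) (a i)
  2≤deg-a i = 2≤deg (H k) (v≢b {i}) a~v a~b

  2≤deg-v : ∀ i → 2 ≤ deg (H k) (v i)
  2≤deg-v i = 2≤deg (H k) a≢v v~a (Adj-v-v (other-≢ i ∘ sym))

  pendant⇒b : ∀ {u} → u ∈ₗ pendants (H k) → ∃ λ i → u ≡ b i
  pendant⇒b {u} u∈ with onPath u | ∈pendants⁻ (H k) u∈
  ... | at i 0F | deg≡1 = ⊥-elim (1+n≰n (subst (2 ≤_) deg≡1 (2≤deg-v i)))
  ... | at i 1F | deg≡1 = ⊥-elim (1+n≰n (subst (2 ≤_) deg≡1 (2≤deg-a i)))
  ... | at i 2F | _     = i , refl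

  b∈pendants : ∀ i → b i ∈ₗ pendants (H k)
  b∈pendants i = ∈pendants⁺ (H k) (deg-b i)

  attachedTo-b : ∀ j → ∃ λ i → attachedTo j ≡ b i
  attachedTo-b j = pendant⇒b (∈-lookup j)

  c : Fin k → Fin (n (G k))
  c i = new (Any.index (b∈pendants i))

  Tip : Fin k → Fin (n (G k)) → Set
  Tip i x = x ≡ old (b i) ⊎ ∃ λ j → x ≡ new j × attachedTo j ≡ b i

  Arm : Fin k → Fin (n (G k)) → Set
  Arm i x = x ≡ old (a i) ⊎ Tip i x

  Tip-unique : ∀ {i j x} → Tip i x → Tip j x → i ≡ j
  Tip-unique (inj₁ refl)            (inj₁ eq)             = proj₁ (vtx-injective (old-injective eq))
  Tip-unique (inj₁ refl)            (inj₂ (_ , eq , _))   = ⊥-elim (old≢new eq)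
  Tip-unique (inj₂ (_ , refl , _))  (inj₁ eq)             = ⊥-elim (old≢new (sym eq))
  Tip-unique (inj₂ (_ , refl , e₁)) (inj₂ (_ , eq , e₂)) with new-injective eq
  ... | refl = proj₁ (vtx-injective (trans (sym e₁) e₂))

  Arm-Tip-unique : ∀ {i j x} → Arm i x → Tip j x → i ≡ j
  Arm-Tip-unique (inj₁ refl) (inj₁ eq)           = ⊥-elim (a≢b (old-injective eq))
  Arm-Tip-unique (inj₁ refl) (inj₂ (_ , eq , _)) = ⊥-elim (old≢new eq)
  Arm-Tip-unique (inj₂ tip)  tip′                = Tip-unique tip tip′

  Tip-closed : ∀ {i s w} → Tip i s → Adj (G k) s w → Tip i w ⊎ (s ≡ old (b i) × w ≡ old (a i))
  Tip-closed {w = w} (inj₁ refl) s~w with oldOrNew w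
  ... | isOld u = inj₂ (refl , cong old (Adj-b⁻ (Adj-old⁻ s~w)))
  ... | isNew j = inj₁ (inj₂ (j , refl , sym (old-injective (Adj-into-new⁻ s~w))))
  Tip-closed (inj₂ (j , refl , e)) s~w = inj₁ (inj₁ (trans (Adj-new⁻ s~w) (cong old e)))

  Arm-closed : ∀ {i s w} → Arm i s → Adj (G k) s w → Arm i w ⊎ (s ≡ old (a i) × w ≡ old (v i))
  Arm-closed {i} {w = w} (inj₁ refl) s~w with oldOrNew w
  ... | isOld u = [ (λ u≡v → inj₂ (refl , cong old u≡v)) , (λ u≡b → inj₁ (inj₂ (inj₁ (cong old u≡b)))) ]′
                      (Adj-a⁻ (Adj-old⁻ s~w))
  ... | isNew j with attachedTo-b j
  ...   | _ , e = ⊥-elim (a≢b (trans (old-injective (Adj-into-new⁻ s~w)) e))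
  Arm-closed (inj₂ tip) s~w = inj₁ ([ inj₂ , inj₁ ∘ proj₂ ]′ (Tip-closed tip s~w))

  N[c]⊆Tip : ∀ {i x} → x ≡ c i ⊎ Adj (G k) x (c i) → Tip i x
  N[c]⊆Tip {i} (inj₁ refl) = inj₂ (_ , refl , sym (lookup-index (b∈pendants i)))
  N[c]⊆Tip {i} (inj₂ x~c)  = inj₁ (trans (Adj-into-new⁻ x~c) (cong old (sym (lookup-index (b∈pendants i)))))

  Root : Fin (n (G k)) → Set
  Root x = x ≡ old (a i₀) ⊎ ∃ λ j → x ≡ old (v j)

  N[v]⊆Root : ∀ {x} → x ≡ old (v i₀) ⊎ Adj (G k) x (old (v i₀)) → Root x
  N[v]⊆Root (inj₁ refl) = inj₂ (i₀ , refl)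
  N[v]⊆Root {x} (inj₂ x~v) with oldOrNew x
  ... | isOld u = Sum.map (cong old) (λ (j , u≡v) → j , cong old u≡v) (Adj-into-v⁻ (Adj-old⁻ x~v))
  ... | isNew j with attachedTo-b j
  ...   | _ , e = ⊥-elim (v≢b (trans (old-injective (Adj-new⁻ x~v)) e))

  Root-Tip-disjoint : ∀ {i x} → Root x → Tip i x → ⊥
  Root-Tip-disjoint (inj₁ refl)       (inj₁ eq)           = a≢b (old-injective eq)
  Root-Tip-disjoint (inj₂ (_ , refl)) (inj₁ eq)           = v≢b (old-injective eq)
  Root-Tip-disjoint (inj₁ refl)       (inj₂ (_ , eq , _)) = old≢new eq
  Root-Tip-disjoint (inj₂ (_ , refl)) (inj₂ (_ , eq , _)) = old≢new eq

  module _ {X : Subset (n (G k))} (dom : Dominating (G k) X) where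

    Tip-dominator : ∀ i → ∃ λ x → x ∈ X × Tip i x
    Tip-dominator i with dominator (G k) dom (c i)
    ... | x , x∈X , x∈N[c] = x , x∈X , N[c]⊆Tip x∈N[c]

    Root-dominator : ∃ λ x → x ∈ X × Root x
    Root-dominator with dominator (G k) dom (old (v i₀))
    ... | x , x∈X , x∈N[v] = x , x∈X , N[v]⊆Root x∈N[v]

    dominators : Fin (suc k) → Fin (n (G k))
    dominators zero    = proj₁ Root-dominator
    dominators (suc i) = proj₁ (Tip-dominator i)

    Root-dominators : Root (dominators zero)
    Root-dominators = proj₂ (proj₂ Root-dominator)

    Tip-dominators : ∀ i → Tip i (dominators (suc i))
    Tip-dominators i = proj₂ (proj₂ (Tip-dominator i))

    dominators-injective : Injective _≡_ _≡_ dominators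
    dominators-injective {zero}  {zero}  _  = refl
    dominators-injective {zero}  {suc j} eq =
      ⊥-elim (Root-Tip-disjoint (subst Root eq Root-dominators) (Tip-dominators j))
    dominators-injective {suc i} {zero}  eq =
      ⊥-elim (Root-Tip-disjoint (subst Root (sym eq) Root-dominators) (Tip-dominators i))
    dominators-injective {suc i} {suc j} eq =
      cong suc (Tip-unique (Tip-dominators i) (subst (Tip j) (sym eq) (Tip-dominators j)))

    γ-lower : k + 1 ≤ Subset.∣ X ∣
    γ-lower = subst (_≤ Subset.∣ X ∣) (+-comm 1 k) (injective⇒≤∣p∣ X dominators dominators-injective dominators-∈)
      where
      dominators-∈ : ∀ t → dominators t ∈ X
      dominators-∈ zero    = proj₁ (proj₂ Root-dominator)
      dominators-∈ (suc i) = proj₁ (proj₂ (Tip-dominator i))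

  γ-witness : Fin (suc k) → Fin (n (G k))
  γ-witness zero    = old (v i₀)
  γ-witness (suc i) = old (b i)

  γ-witness-injective : Injective _≡_ _≡_ γ-witness
  γ-witness-injective {zero}  {zero}  _  = refl
  γ-witness-injective {zero}  {suc j} eq = ⊥-elim (v≢b (old-injective eq))
  γ-witness-injective {suc i} {zero}  eq = ⊥-elim (v≢b (old-injective (sym eq)))
  γ-witness-injective {suc i} {suc j} eq = cong suc (proj₁ (vtx-injective (old-injective eq)))

  γ-witness-dominating : Dominating (G k) (image γ-witness)
  γ-witness-dominating x with oldOrNew x
  ... | isNew j with attachedTo-b j
  ...   | i , e = inj₂ (old (b i) , ∈-image γ-witness (suc i) , Adj-attached e)
  γ-witness-dominating x | isOld u with onPath u
  ... | at i 1F = inj₂ (old (b i) , ∈-image γ-witness (suc i) , Adj-old⁺ b~a)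
  ... | at i 2F = inj₁ (∈-image γ-witness (suc i))
  ... | at i 0F with i₀ ≟ᶠ i
  ...   | yes refl = inj₁ (∈-image γ-witness zero)
  ...   | no i₀≢i  = inj₂ (old (v i₀) , ∈-image γ-witness zero , Adj-old⁺ (Adj-v-v i₀≢i))

  γ≡k+1 : IsDomNumber (G k) (k + 1)
  γ≡k+1 = (image γ-witness , γ-witness-dominating , trans (∣image∣≡ γ-witness γ-witness-injective) (+-comm 1 k))
        , λ X dom → γ-lower dom

  module _ {X : Subset (n (G k))} (cdom : ConnDominating (G k) X) where

    old∈ConnDominating : ∀ u → old u ∈ X
    old∈ConnDominating u with onPath u
    ... | at i p = on-arm p
      where
      s : ∃ λ x → x ∈ X × Tip i x
      s = Tip-dominator (proj₁ cdom) i
      t : ∃ λ x → x ∈ X × Tip (other i) x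
      t = Tip-dominator (proj₁ cdom) (other i)
      walk : ReachIn (G k) X (proj₁ s) (proj₁ t)
      walk = proj₂ cdom _ _ (proj₁ (proj₂ s)) (proj₁ (proj₂ t))
      t∉Arm : ¬ Arm i (proj₁ t)
      t∉Arm arm = other-≢ i (sym (Arm-Tip-unique arm (proj₂ (proj₂ t))))
      via-a : old (a i) ∈ X × old (v i) ∈ X
      via-a = exit∈ (G k) (Arm i) Arm-closed walk (inj₂ (proj₂ (proj₂ s))) t∉Arm
      via-b : old (b i) ∈ X × old (a i) ∈ X
      via-b = exit∈ (G k) (Tip i) Tip-closed walk (proj₂ (proj₂ s)) (t∉Arm ∘ inj₂)
      on-arm : ∀ p → old (vtx i p) ∈ X
      on-arm 0F = proj₂ via-a
      on-arm 1F = proj₁ via-a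
      on-arm 2F = proj₁ via-b

    γc-lower : 3 * k ≤ Subset.∣ X ∣
    γc-lower = subst (_≤ Subset.∣ X ∣) (*-comm k 3) (injective⇒≤∣p∣ X old old-injective old∈ConnDominating)

  old-vertices : Subset (n (G k))
  old-vertices = image old

  old-vertices-dominating : Dominating (G k) old-vertices
  old-vertices-dominating x with oldOrNew x
  ... | isOld u = inj₁ (∈-image old u)
  ... | isNew j = inj₂ (old (attachedTo j) , ∈-image old _ , Adj-attached refl)

  old-vertices-connected : InducesConnected (G k) old-vertices
  old-vertices-connected x y x∈ y∈ with ∈-image⁻ old x∈ | ∈-image⁻ old y∈
  ... | u , refl | w , refl with onPath u | onPath w
  ...   | at i p | at j q = ReachIn-trans (G k) (up i p) (ReachIn-trans (G k) (across i j) (down j q))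
    where
    edge : ∀ {u w} → Adj (H k) u w → ReachIn (G k) old-vertices (old u) (old w)
    edge u~w = ReachIn-edge (G k) (∈-image old _) (∈-image old _) (Adj-old⁺ u~w)
    up : ∀ i p → ReachIn (G k) old-vertices (old (vtx i p)) (old (v i))
    up i 0F = here (∈-image old _)
    up i 1F = edge a~v
    up i 2F = ReachIn-trans (G k) (edge b~a) (edge a~v)
    down : ∀ i p → ReachIn (G k) old-vertices (old (v i)) (old (vtx i p))
    down i 0F = here (∈-image old _)
    down i 1F = edge v~a
    down i 2F = ReachIn-trans (G k) (edge v~a) (edge a~b)
    across : ∀ i j → ReachIn (G k) old-vertices (old (v i)) (old (v j))
    across i j with i ≟ᶠ j
    ... | yes refl = here (∈-image old _)
    ... | no i≢j   = edge (Adj-v-v i≢j)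

  γc≡3k : IsConnDomNumber (G k) (3 * k)
  γc≡3k = ( old-vertices , (old-vertices-dominating , old-vertices-connected)
          , trans (∣image∣≡ old old-injective) (*-comm k 3))
        , λ X cdom → γc-lower cdom

γ-values : ∀ k → 2 ≤ k → IsDomNumber (G k) (k + 1) × IsConnDomNumber (G k) (3 * k)
γ-values (suc (suc k)) _         = γ≡k+1 , γc≡3k
  where open Domination (2 + k) zero (suc zero) (λ ())
γ-values (suc zero)    (s≤s ())

toℚᵘ-∣-∣ : ∀ p → toℚᵘ ∣ p ∣ ℚᵘ.≃ ℚᵘ.∣ toℚᵘ p ∣
toℚᵘ-∣-∣ (mkℚ _ _ _) = ℚᵘₚ.≃-refl

toℚᵘ-homo-− : ∀ p q → toℚᵘ (p - q) ℚᵘ.≃ toℚᵘ p ℚᵘ.- toℚᵘ q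
toℚᵘ-homo-− p q = ℚᵘₚ.≃-trans (toℚᵘ-homo-+ p (- q)) (ℚᵘₚ.+-congʳ (toℚᵘ p) (toℚᵘ-homo‿- q))

3k-3[1+k]≡-3 : ∀ k → + (3 * k) ℤ.* + 1 ℤ.+ ℤ.- + 3 ℤ.* + suc k ≡ ℤ.- + 3
3k-3[1+k]≡-3 k = trans (cong₂ (λ x y → x ℤ.* + 1 ℤ.+ ℤ.- + 3 ℤ.* y) (ℤₚ.pos-* 3 k) (ℤₚ.pos-+ 1 k)) (identity (+ k))
  where
  identity : ∀ x → + 3 ℤ.* x ℤ.* + 1 ℤ.+ ℤ.- + 3 ℤ.* (+ 1 ℤ.+ x) ≡ ℤ.- + 3
  identity = solve-∀

∣3k/[1+k]-3∣<ε : ∀ {n d} .(c : Coprime (suc n) (suc d)) k → 3 * suc d ≤ k →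
                 ∣ (+ (3 * k) / suc k) - (+ 3 / 1) ∣ < mkℚ (+ suc n) d c
∣3k/[1+k]-3∣<ε {n} {d} c k 3[1+d]≤k = toℚᵘ-cancel-< (ℚᵘₚ.<-respˡ-≃ (ℚᵘₚ.≃-sym ≃∣x-t∣) ∣x-t∣<ε)
  where
  -- mkℚᵘ n d stands for n / (1 + d).
  x t : ℚᵘ.ℚᵘ
  x = ℚᵘ.mkℚᵘ (+ (3 * k)) k
  t = ℚᵘ.mkℚᵘ (+ 3) 0

  toℚᵘ-difference : toℚᵘ ((+ (3 * k) / suc k) - (+ 3 / 1)) ℚᵘ.≃ x ℚᵘ.- t
  toℚᵘ-difference = ℚᵘₚ.≃-trans (toℚᵘ-homo-− (+ (3 * k) / suc k) (+ 3 / 1))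
                                (ℚᵘₚ.+-cong (toℚᵘ-fromℚᵘ x) (ℚᵘₚ.-‿cong (toℚᵘ-fromℚᵘ t)))

  ≃∣x-t∣ : toℚᵘ ∣ (+ (3 * k) / suc k) - (+ 3 / 1) ∣ ℚᵘ.≃ ℚᵘ.∣ x ℚᵘ.- t ∣
  ≃∣x-t∣ = ℚᵘₚ.≃-trans (toℚᵘ-∣-∣ ((+ (3 * k) / suc k) - (+ 3 / 1))) (ℚᵘₚ.∣-∣-cong toℚᵘ-difference)

  3[1+d]<[1+n][1+k] : + 3 ℤ.* + suc d ℤ.< + suc n ℤ.* + suc (k * 1)
  3[1+d]<[1+n][1+k] = subst₂ ℤ._<_ (sym (ℤₚ.pos-* 3 (suc d))) (sym (ℤₚ.pos-* (suc n) (suc (k * 1))))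
    (+<+ (≤-trans (s≤s 3[1+d]≤k)
                  (subst (λ z → suc k ≤ suc n * suc z) (sym (*-identityʳ k)) (m≤n*m (suc k) (suc n)))))

  ∣x-t∣<ε : ℚᵘ.∣ x ℚᵘ.- t ∣ ℚᵘ.< ℚᵘ.mkℚᵘ (+ suc n) d
  ∣x-t∣<ε = ℚᵘ.*<* (subst (λ z → + ℤ.∣ z ∣ ℤ.* + suc d ℤ.< + suc n ℤ.* + suc (k * 1))
                          (sym (3k-3[1+k]≡-3 k)) 3[1+d]<[1+n][1+k])

3k/[1+k]→3 : ∀ ε → 0ℚ < ε → ∃ λ K → ∀ k → K ≤ k → ∣ (+ (3 * k) / suc k) - (+ 3 / 1) ∣ < ε
3k/[1+k]→3 (mkℚ (+ zero)  _ _) (*<* (+<+ ()))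
3k/[1+k]→3 (mkℚ -[1+ _ ]  _ _) (*<* ())
3k/[1+k]→3 (mkℚ (+ suc n) d c) _ = 3 * suc d , ∣3k/[1+k]-3∣<ε c

γc/γ→3 : (ε : ℚ) → 0ℚ < ε → Σ ℕ λ K → (k : ℕ) → K ≤ k → (a b : ℕ) → .{{_ : NonZero a}}
         → IsDomNumber (G k) a → IsConnDomNumber (G k) b → ∣ (+ b / a) - (+ 3 / 1) ∣ < ε
γc/γ→3 ε ε>0 with 3k/[1+k]→3 ε ε>0
... | K , close = 2 + K , λ k 2+K≤k a b γ γc →
  let values = γ-values k (≤-trans (m≤m+n 2 K) 2+K≤k) in
  ratio k a b (trans (IsDomNumber-unique (G k) γ (proj₁ values)) (+-comm k 1))
              (IsConnDomNumber-unique (G k) γc (proj₂ values))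
              (close k (m+n≤o⇒n≤o 2 2+K≤k))
  where
  ratio : ∀ k a b .{{_ : NonZero a}} → a ≡ suc k → b ≡ 3 * k →
          ∣ (+ (3 * k) / suc k) - (+ 3 / 1) ∣ < ε → ∣ (+ b / a) - (+ 3 / 1) ∣ < ε
  ratio k .(suc k) .(3 * k) refl refl lt = lt

mainTheorem6 : ((k : ℕ) → P-free 9 (G k) × C-free 9 (G k))
    × ((k : ℕ) → 2 ≤ k → IsDomNumber (G k) (k + 1) × IsConnDomNumber (G k) (3 * k))
    × ((ε : ℚ) → 0ℚ < ε → Σ ℕ λ K → (k : ℕ) → K ≤ k → (a b : ℕ) → .{{_ : NonZero a}}
        → IsDomNumber (G k) a → IsConnDomNumber (G k) b
        → ∣ (+ b / a) - (+ 3 / 1) ∣ < ε)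
mainTheorem6 = (λ k → G-P₉-free k , G-C₉-free k) , γ-values , γc/γ→3
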